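{- Let $\alpha,\beta\in\mathcal{E}$ be nonzero and let $t$ be any positive real number. Then there exists $\eta\in\mathcal{E}_{\mathbb{Q}}$ such that $\ell(\alpha-\eta\beta)<t$. Moreover, such an $\eta$ may be effectively computed in terms of $\alpha,\beta,t$.
   Context: $\mathcal{E}$ denotes the ring of functions $\alpha:\mathbb{N}\to\mathbb{Q}$ of the form $\alpha(n)=c_1a_1^n+\cdots+c_ra_r^n$ with $c_i\in\mathbb{Q}$, $a_i$ positive integers, and $r$ arbitrary. $\mathcal{E}_{\mathbb{Q}}$ denotes the analogous ring where the $a_i$ are allowed to be positive rational numbers. For $\alpha\in\mathcal{E}_{\mathbb{Q}}$ written as $\alpha(n)=\sum_{i=1}^r c_ia_i^n$ with nonzero $c_i$ and distinct $a_i$, set $\ell(\alpha)=\max(a_1,\ldots,a_r)$, and $\ell(0)=0$.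
   Formalization: The positive number t ranges over the positive rationals rather than over all positive real numbers. -}

module Defs where

open import Data.Nat using (ℕ; zero; suc)
import Data.Nat as ℕ
open import Data.Integer using (+_)
open import Data.Rational using (ℚ; 0ℚ; 1ℚ; _+_; _*_; _-_; _<_; _⊔_; _/_)
open import Data.List using (List; []; _∷_; map; foldr)
open import Data.List.Relation.Unary.All using (All)
open import Data.List.Relation.Unary.Unique.Propositional using (Unique)
open import Data.Product using (Σ; _×_; _,_; proj₁; proj₂)
open import Data.Empty using (⊥)
open import Relation.Binary.PropositionalEquality using (_≡_; _≢_)

_^ℚ_ : ℚ → ℕ → ℚ
q ^ℚ zero = 1ℚ
q ^ℚ suc n = q * (q ^ℚ n)

ℕ→ℚ : ℕ → ℚ
ℕ→ℚ a = + a / 1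

-- A representation is a finite list of terms (c , a) standing for c * a ^ n.
-- Integer-base version (for the ring ℰ) and rational-base version (for ℰ_ℚ).
evalℕ : List (ℚ × ℕ) → ℕ → ℚ
evalℕ []             n = 0ℚ
evalℕ ((c , a) ∷ L)  n = c * (ℕ→ℚ a ^ℚ n) + evalℕ L n

evalℚ : List (ℚ × ℚ) → ℕ → ℚ
evalℚ []             n = 0ℚ
evalℚ ((c , a) ∷ L)  n = c * (a ^ℚ n) + evalℚ L n

-- α ∈ ℰ : α(n) = Σ cᵢ aᵢⁿ with cᵢ ∈ ℚ and aᵢ positive integers.
-- The witness (a representation) is data, so it is available to computations.
InE : (ℕ → ℚ) → Set
InE α = Σ (List (ℚ × ℕ)) λ L →
          All (λ p → 0 ℕ.< proj₂ p) L × (∀ n → α n ≡ evalℕ L n)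

InEQ : (ℕ → ℚ) → Set
InEQ α = Σ (List (ℚ × ℚ)) λ L →
           All (λ p → 0ℚ < proj₂ p) L × (∀ n → α n ≡ evalℚ L n)

ReducedRep : (ℕ → ℚ) → List (ℚ × ℚ) → Set
ReducedRep α L =
  All (λ p → proj₁ p ≢ 0ℚ) L × All (λ p → 0ℚ < proj₂ p) L ×
  Unique (map proj₂ L) × (∀ n → α n ≡ evalℚ L n)

maxBase : List (ℚ × ℚ) → ℚ
maxBase L = foldr _⊔_ 0ℚ (map proj₂ L)

-- ℓ(α) = m : m is the largest base in a reduced representation of α
-- (ℓ(0) = 0 via the empty representation).
IsEll : (ℕ → ℚ) → ℚ → Set
IsEll α m = Σ (List (ℚ × ℚ)) λ L → ReducedRep α L × m ≡ maxBase L

Nonzero : (ℕ → ℚ) → Set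
Nonzero α = (∀ n → α n ≡ 0ℚ) → ⊥

-- Normalise β so that it has a dominant term: β(n) = b Bⁿ + R(n), with b ≠ 0 and every
-- base of R below B. Then β = b Bⁿ (1 − δ) where δ(n) = −R(n) / (b Bⁿ) has all its bases
-- in (0, 1), and the truncated geometric series η = α (b Bⁿ)⁻¹ (1 + δ + ⋯ + δ^(K−1))
-- leaves the remainder α − η β = α δ^K. Its bases are at most A r^K, where A and r < 1 are
-- the largest bases of α and δ, and Bernoulli's inequality makes this smaller than t for
-- large K.

module Submission where

open import Defs
open import Data.Nat.Base as ℕ using (ℕ; zero; suc)
import Data.Nat.Properties as ℕ
import Data.Integer.Base as ℤ
import Data.Integer.Properties as ℤ
open import Data.Rational
open import Data.Rational.Properties
import Data.Rational.Unnormalised as ℚᵘ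
import Data.Rational.Unnormalised.Properties as ℚᵘ
open import Data.Rational.Solver using (module +-*-Solver)
open +-*-Solver
open import Data.Product using (Σ; ∃-syntax; _×_; _,_; proj₁; proj₂)
open import Data.Sum using (inj₁; inj₂)
open import Data.List using (List; []; _∷_; _++_; map; foldr; filter)
open import Data.List.Relation.Unary.All as All using (All; []; _∷_)
import Data.List.Relation.Unary.All.Properties as All
open import Data.List.Relation.Unary.AllPairs using (AllPairs; []; _∷_)
import Data.List.Relation.Unary.AllPairs as AllPairs
import Data.List.Relation.Unary.AllPairs.Properties as AllPairs
open import Data.List.Relation.Unary.Unique.Propositional using (Unique)
open import Data.Empty using (⊥-elim)
open import Function using (_∘_)
open import Relation.Binary.Definitions using (tri<; tri≈; tri>)
open import Relation.Binary.PropositionalEquality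
open import Relation.Nullary using (yes; no; ¬?)

*-positive : ∀ {p q} → 0ℚ < p → 0ℚ < q → 0ℚ < p * q
*-positive {p} {q} 0<p 0<q = positive⁻¹ (p * q) {{pos*pos⇒pos p {{positive 0<p}} q {{positive 0<q}}}}

*-nonNegative : ∀ {p q} → 0ℚ ≤ p → 0ℚ ≤ q → 0ℚ ≤ p * q
*-nonNegative {p} {q} 0≤p 0≤q =
  nonNegative⁻¹ (p * q) {{nonNeg*nonNeg⇒nonNeg p {{nonNegative 0≤p}} q {{nonNegative 0≤q}}}}

p≤1⇒0≤1-p : ∀ {p} → p ≤ 1ℚ → 0ℚ ≤ 1ℚ - p
p≤1⇒0≤1-p {p} p≤1 = subst (_≤ 1ℚ - p) (+-inverseʳ p) (+-monoˡ-≤ (- p) p≤1)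

p<1⇒0<1-p : ∀ {p} → p < 1ℚ → 0ℚ < 1ℚ - p
p<1⇒0<1-p {p} p<1 = subst (_< 1ℚ - p) (+-inverseʳ p) (+-monoˡ-< (- p) p<1)

-- Powers and the archimedean property

^ℚ-distribʳ-* : ∀ p q n → (p * q) ^ℚ n ≡ p ^ℚ n * q ^ℚ n
^ℚ-distribʳ-* p q zero = refl
^ℚ-distribʳ-* p q (suc n) rewrite ^ℚ-distribʳ-* p q n =
  solve 4 (λ p q x y → (p :* q) :* (x :* y) := (p :* x) :* (q :* y)) refl p q (p ^ℚ n) (q ^ℚ n)

1^ℚn≡1 : ∀ n → 1ℚ ^ℚ n ≡ 1ℚ
1^ℚn≡1 zero = refl
1^ℚn≡1 (suc n) rewrite 1^ℚn≡1 n = refl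

^ℚ-nonNegative : ∀ {p} n → 0ℚ ≤ p → 0ℚ ≤ p ^ℚ n
^ℚ-nonNegative zero 0≤p = <⇒≤ (positive⁻¹ 1ℚ)
^ℚ-nonNegative (suc n) 0≤p = *-nonNegative 0≤p (^ℚ-nonNegative n 0≤p)

^ℚ-≤1 : ∀ {p} n → 0ℚ ≤ p → p ≤ 1ℚ → p ^ℚ n ≤ 1ℚ
^ℚ-≤1 zero 0≤p p≤1 = ≤-refl
^ℚ-≤1 {p} (suc n) 0≤p p≤1 =
  ≤-trans (*-monoˡ-≤-nonNeg p {{nonNegative 0≤p}} (^ℚ-≤1 n 0≤p p≤1))
          (subst (_≤ 1ℚ) (sym (*-identityʳ p)) p≤1)

-- The unary embedding ℕ → ℚ, so that Bernoulli's inequality can be proved by recursion.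
fromℕ : ℕ → ℚ
fromℕ zero = 0ℚ
fromℕ (suc k) = 1ℚ + fromℕ k

fromℕ-nonNegative : ∀ k → 0ℚ ≤ fromℕ k
fromℕ-nonNegative zero = ≤-refl
fromℕ-nonNegative (suc k) = ≤-trans (fromℕ-nonNegative k)
  (subst (_≤ 1ℚ + fromℕ k) (+-identityˡ (fromℕ k)) (+-monoˡ-≤ (fromℕ k) (<⇒≤ (positive⁻¹ 1ℚ))))

module _ where

  open import Data.Integer.Base using (+_; -[1+_])

  toℚᵘ-fromℕ : ∀ k → toℚᵘ (fromℕ k) ℚᵘ.≃ ℚᵘ.mkℚᵘ (+ k) 0
  toℚᵘ-fromℕ zero = ℚᵘ.≃-refl
  toℚᵘ-fromℕ (suc k) = ℚᵘ.≃-trans (toℚᵘ-homo-+ 1ℚ (fromℕ k))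
    (ℚᵘ.≃-trans (ℚᵘ.+-congʳ (toℚᵘ 1ℚ) (toℚᵘ-fromℕ k)) (ℚᵘ.*≡* (cong (ℤ._* + 1) 1+k*1≡1+k)))
    where
    1+k*1≡1+k : + 1 ℤ.+ + k ℤ.* + 1 ≡ + suc k
    1+k*1≡1+k = cong (ℤ._+_ (+ 1)) (ℤ.*-identityʳ (+ k))

  archimedean : ∀ p → ∃[ k ] p < fromℕ k
  archimedean (mkℚ n d _) = suc ℤ.∣ n ∣ ,
    toℚᵘ-cancel-< (ℚᵘ.<-respʳ-≃ (ℚᵘ.≃-sym (toℚᵘ-fromℕ (suc ℤ.∣ n ∣))) (ℚᵘ.*<* (n<1+∣n∣ n)))
    where
    n<1+∣n∣ : ∀ n → n ℤ.* + 1 ℤ.< + suc ℤ.∣ n ∣ ℤ.* + suc d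
    n<1+∣n∣ (+ k) rewrite ℤ.*-identityʳ (+ k) =
      ℤ.+<+ (ℕ.s≤s (ℕ.≤-trans (ℕ.m≤m*n k (suc d)) (ℕ.m≤n+m (k ℕ.* suc d) d)))
    n<1+∣n∣ -[1+ k ] = ℤ.-<+

bernoulli : ∀ {r} k → 0ℚ ≤ r → r ≤ 1ℚ → r ^ℚ k * (1ℚ + fromℕ k * (1ℚ - r)) ≤ 1ℚ
bernoulli {r} zero 0≤r r≤1 =
  ≤-reflexive (solve 1 (λ r → con 1ℚ :* (con 1ℚ :+ con 0ℚ :* (con 1ℚ :- r)) := con 1ℚ) refl r)
bernoulli {r} (suc k) 0≤r r≤1 = begin
  r * r ^ℚ k * (1ℚ + (1ℚ + fromℕ k) * (1ℚ - r))
    ≡⟨ solve 3 (λ r x n → r :* x :* (con 1ℚ :+ (con 1ℚ :+ n) :* (con 1ℚ :- r))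
         := r :* (x :* (con 1ℚ :+ n :* (con 1ℚ :- r))) :+ (r :* x) :* (con 1ℚ :- r))
         refl r (r ^ℚ k) (fromℕ k) ⟩
  r * (r ^ℚ k * (1ℚ + fromℕ k * (1ℚ - r))) + r * r ^ℚ k * (1ℚ - r)
    ≤⟨ +-mono-≤ (*-monoˡ-≤-nonNeg r {{nonNegative 0≤r}} (bernoulli k 0≤r r≤1))
                (*-monoʳ-≤-nonNeg (1ℚ - r) {{nonNegative (p≤1⇒0≤1-p r≤1)}} (^ℚ-≤1 (suc k) 0≤r r≤1)) ⟩
  r * 1ℚ + 1ℚ * (1ℚ - r)
    ≡⟨ solve 1 (λ r → r :* con 1ℚ :+ con 1ℚ :* (con 1ℚ :- r) := con 1ℚ) refl r ⟩
  1ℚ ∎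
  where open ≤-Reasoning

geometric-decay : ∀ {a r t} → 0ℚ ≤ a → 0ℚ ≤ r → r < 1ℚ → 0ℚ < t → ∃[ k ] a * r ^ℚ k < t
geometric-decay {a} {r} {t} 0≤a 0≤r r<1 0<t = k , a*rᵏ<t
  where
  d = 1ℚ - r
  instance
    td-positive : Positive (t * d)
    td-positive = positive (*-positive 0<t (p<1⇒0<1-p r<1))
    td-nonZero : NonZero (t * d)
    td-nonZero = pos⇒nonZero (t * d)
  k = proj₁ (archimedean (a * 1/ (t * d)))
  P = 1ℚ + fromℕ k * d
  0≤P : 0ℚ ≤ P
  0≤P = ≤-trans (<⇒≤ (positive⁻¹ 1ℚ)) (subst (_≤ P) (+-identityʳ 1ℚ)
          (+-monoʳ-≤ 1ℚ (*-nonNegative (fromℕ-nonNegative k) (p≤1⇒0≤1-p (<⇒≤ r<1)))))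
  a<tP : a < t * P
  a<tP = begin-strict
    a                      ≡⟨ sym (trans (*-assoc a _ (t * d))
                                  (trans (cong (a *_) (*-inverseˡ (t * d))) (*-identityʳ a))) ⟩
    a * 1/ (t * d) * (t * d) <⟨ *-monoˡ-<-pos (t * d) (proj₂ (archimedean (a * 1/ (t * d)))) ⟩
    fromℕ k * (t * d)      ≡⟨ sym (+-identityˡ _) ⟩
    0ℚ + fromℕ k * (t * d) <⟨ +-monoˡ-< (fromℕ k * (t * d)) 0<t ⟩
    t + fromℕ k * (t * d)  ≡⟨ solve 3 (λ t n d → t :+ n :* (t :* d) := t :* (con 1ℚ :+ n :* d))
                                refl t (fromℕ k) d ⟩
    t * P                  ∎
    where open ≤-Reasoning
  a*rᵏ<t : a * r ^ℚ k < t
  a*rᵏ<t = *-cancelʳ-<-nonNeg P {{nonNegative 0≤P}} (begin-strict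
    a * r ^ℚ k * P   ≡⟨ *-assoc a (r ^ℚ k) P ⟩
    a * (r ^ℚ k * P) ≤⟨ *-monoˡ-≤-nonNeg a {{nonNegative 0≤a}} (bernoulli k 0≤r (<⇒≤ r<1)) ⟩
    a * 1ℚ           ≡⟨ *-identityʳ a ⟩
    a                <⟨ a<tP ⟩
    t * P            ∎)
    where open ≤-Reasoning

-- Arithmetic of exponential polynomials

Rep : Set
Rep = List (ℚ × ℚ)

Bases : (ℚ → Set) → Rep → Set
Bases P = All (P ∘ proj₂)

evalℚ-++ : ∀ L M n → evalℚ (L ++ M) n ≡ evalℚ L n + evalℚ M n
evalℚ-++ [] M n = sym (+-identityˡ _)
evalℚ-++ ((c , a) ∷ L) M n rewrite evalℚ-++ L M n = sym (+-assoc (c * a ^ℚ n) (evalℚ L n) (evalℚ M n))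

scale : ℚ × ℚ → Rep → Rep
scale t = map (λ s → (proj₁ t * proj₁ s , proj₂ t * proj₂ s))

evalℚ-scale : ∀ d e L n → evalℚ (scale (d , e) L) n ≡ d * e ^ℚ n * evalℚ L n
evalℚ-scale d e [] n = sym (*-zeroʳ (d * e ^ℚ n))
evalℚ-scale d e ((c , a) ∷ L) n rewrite evalℚ-scale d e L n | ^ℚ-distribʳ-* e a n =
  solve 5 (λ d c x y w → d :* c :* (x :* y) :+ d :* x :* w := d :* x :* (c :* y :+ w))
    refl d c (e ^ℚ n) (a ^ℚ n) (evalℚ L n)

infixl 7 _⊗_
infixr 8 _^ᴿ_

_⊗_ : Rep → Rep → Rep
[] ⊗ M = []
(t ∷ L) ⊗ M = scale t M ++ L ⊗ M

evalℚ-⊗ : ∀ L M n → evalℚ (L ⊗ M) n ≡ evalℚ L n * evalℚ M n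
evalℚ-⊗ [] M n = sym (*-zeroˡ (evalℚ M n))
evalℚ-⊗ ((c , a) ∷ L) M n rewrite evalℚ-++ (scale (c , a) M) (L ⊗ M) n
  | evalℚ-scale c a M n | evalℚ-⊗ L M n = sym (*-distribʳ-+ (evalℚ M n) (c * a ^ℚ n) (evalℚ L n))

_^ᴿ_ : Rep → ℕ → Rep
L ^ᴿ zero = (1ℚ , 1ℚ) ∷ []
L ^ᴿ suc k = L ⊗ L ^ᴿ k

evalℚ-^ᴿ : ∀ L k n → evalℚ (L ^ᴿ k) n ≡ evalℚ L n ^ℚ k
evalℚ-^ᴿ L zero n rewrite 1^ℚn≡1 n = trans (+-identityʳ _) (*-identityˡ _)
evalℚ-^ᴿ L (suc k) n rewrite evalℚ-⊗ L (L ^ᴿ k) n | evalℚ-^ᴿ L k n = refl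

geometric : Rep → ℕ → Rep
geometric L zero = []
geometric L (suc k) = L ^ᴿ k ++ geometric L k

evalℚ-geometric : ∀ L k n →
  evalℚ (geometric L k) n * (1ℚ - evalℚ L n) + evalℚ L n ^ℚ k ≡ 1ℚ
evalℚ-geometric L zero n = solve 1 (λ x → con 0ℚ :* (con 1ℚ :- x) :+ con 1ℚ := con 1ℚ) refl (evalℚ L n)
evalℚ-geometric L (suc k) n = begin
  evalℚ (L ^ᴿ k ++ geometric L k) n * (1ℚ - x) + x * x ^ℚ k
    ≡⟨ cong (λ s → s * (1ℚ - x) + x * x ^ℚ k)
         (trans (evalℚ-++ (L ^ᴿ k) (geometric L k) n) (cong (_+ g) (evalℚ-^ᴿ L k n))) ⟩
  (x ^ℚ k + g) * (1ℚ - x) + x * x ^ℚ k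
    ≡⟨ solve 3 (λ x y g → (y :+ g) :* (con 1ℚ :- x) :+ x :* y := g :* (con 1ℚ :- x) :+ y)
         refl x (x ^ℚ k) g ⟩
  g * (1ℚ - x) + x ^ℚ k
    ≡⟨ evalℚ-geometric L k n ⟩
  1ℚ ∎
  where
  open ≡-Reasoning
  x = evalℚ L n
  g = evalℚ (geometric L k) n

scale-bases : ∀ {P Q : ℚ → Set} t {L} → (∀ {a} → P a → Q (proj₂ t * a)) →
  Bases P L → Bases Q (scale t L)
scale-bases t f = All.map⁺ ∘ All.map f

⊗-bases : ∀ {P Q R : ℚ → Set} {L M} → (∀ {a b} → P a → Q b → R (a * b)) →
  Bases P L → Bases Q M → Bases R (L ⊗ M)
⊗-bases f [] _ = []
⊗-bases {L = t ∷ _} f (p ∷ ps) qs = All.++⁺ (scale-bases t (f p) qs) (⊗-bases f ps qs)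

^ᴿ-bases : ∀ {P : ℚ → Set} {L} k → P 1ℚ → (∀ {a b} → P a → P b → P (a * b)) →
  Bases P L → Bases P (L ^ᴿ k)
^ᴿ-bases zero p1 f ps = p1 ∷ []
^ᴿ-bases (suc k) p1 f ps = ⊗-bases f ps (^ᴿ-bases k p1 f ps)

geometric-bases : ∀ {P : ℚ → Set} {L} k → P 1ℚ → (∀ {a b} → P a → P b → P (a * b)) →
  Bases P L → Bases P (geometric L k)
geometric-bases zero p1 f ps = []
geometric-bases (suc k) p1 f ps = All.++⁺ (^ᴿ-bases k p1 f ps) (geometric-bases k p1 f ps)

PositiveUpTo : ℚ → ℚ → Set
PositiveUpTo s a = 0ℚ < a × a ≤ s

*-positiveUpTo : ∀ {s u a b} → PositiveUpTo s a → PositiveUpTo u b → PositiveUpTo (s * u) (a * b)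
*-positiveUpTo {s} {u} {a} {b} (0<a , a≤s) (0<b , b≤u) = *-positive 0<a 0<b ,
  ≤-trans (*-monoʳ-≤-nonNeg b {{nonNegative (<⇒≤ 0<b)}} a≤s)
          (*-monoˡ-≤-nonNeg s {{nonNegative (≤-trans (<⇒≤ 0<a) a≤s)}} b≤u)

^ᴿ-positiveUpTo : ∀ {r L} k → Bases (PositiveUpTo r) L → Bases (PositiveUpTo (r ^ℚ k)) (L ^ᴿ k)
^ᴿ-positiveUpTo zero ps = (positive⁻¹ 1ℚ , ≤-refl) ∷ []
^ᴿ-positiveUpTo (suc k) ps = ⊗-bases *-positiveUpTo ps (^ᴿ-positiveUpTo k ps)

maxBase-nonNegative : ∀ L → 0ℚ ≤ maxBase L
maxBase-nonNegative [] = ≤-refl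
maxBase-nonNegative ((c , a) ∷ L) = p≤q⇒p≤r⊔q a (maxBase-nonNegative L)

maxBase-upper : ∀ L → Bases (_≤ maxBase L) L
maxBase-upper [] = []
maxBase-upper ((c , a) ∷ L) = p≤p⊔q a (maxBase L) ∷ All.map (p≤q⇒p≤r⊔q a) (maxBase-upper L)

maxBase-least : ∀ {s} L → 0ℚ ≤ s → Bases (_≤ s) L → maxBase L ≤ s
maxBase-least [] 0≤s _ = 0≤s
maxBase-least (_ ∷ L) 0≤s (a≤s ∷ ps) = ⊔-lub a≤s (maxBase-least L 0≤s ps)

maxBase-< : ∀ {s} L → 0ℚ < s → Bases (_< s) L → maxBase L < s
maxBase-< [] 0<s _ = 0<s
maxBase-< ((c , a) ∷ L) 0<s (a<s ∷ ps) with ⊔-sel a (maxBase L)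
... | inj₁ eq rewrite eq = a<s
... | inj₂ eq rewrite eq = maxBase-< L 0<s ps

-- Reduced representations

insert : ℚ × ℚ → Rep → Rep
insert t [] = t ∷ []
insert (c , a) ((d , b) ∷ L) with <-cmp a b
... | tri< _ _ _ = (d , b) ∷ insert (c , a) L
... | tri≈ _ _ _ = (c + d , b) ∷ L
... | tri> _ _ _ = (c , a) ∷ (d , b) ∷ L

sort : Rep → Rep
sort = foldr insert []

dropZeros : Rep → Rep
dropZeros = filter (λ t → ¬? (proj₁ t ≟ 0ℚ))

reduce : Rep → Rep
reduce = dropZeros ∘ sort

Decreasing : Rep → Set
Decreasing = AllPairs (λ s t → proj₂ t < proj₂ s)

evalℚ-insert : ∀ t L n → evalℚ (insert t L) n ≡ evalℚ (t ∷ L) n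
evalℚ-insert t [] n = refl
evalℚ-insert (c , a) ((d , b) ∷ L) n with <-cmp a b
... | tri< _ _ _ rewrite evalℚ-insert (c , a) L n =
  solve 3 (λ x y z → y :+ (x :+ z) := x :+ (y :+ z)) refl (c * a ^ℚ n) (d * b ^ℚ n) (evalℚ L n)
... | tri≈ _ refl _ =
  solve 4 (λ c d x z → (c :+ d) :* x :+ z := c :* x :+ (d :* x :+ z)) refl c d (a ^ℚ n) (evalℚ L n)
... | tri> _ _ _ = refl

insert-bases : ∀ {P : ℚ → Set} t {L} → P (proj₂ t) → Bases P L → Bases P (insert t L)
insert-bases t pt [] = pt ∷ []
insert-bases (c , a) {(d , b) ∷ L} pa (pb ∷ ps) with <-cmp a b
... | tri< _ _ _ = pb ∷ insert-bases (c , a) pa ps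
... | tri≈ _ _ _ = pb ∷ ps
... | tri> _ _ _ = pa ∷ pb ∷ ps

insert-decreasing : ∀ t {L} → Decreasing L → Decreasing (insert t L)
insert-decreasing t [] = [] ∷ []
insert-decreasing (c , a) {(d , b) ∷ L} (b>L ∷ dec) with <-cmp a b
... | tri< a<b _ _ = insert-bases (c , a) a<b b>L ∷ insert-decreasing (c , a) dec
... | tri≈ _ _ _ = b>L ∷ dec
... | tri> _ _ b<a = (b<a ∷ All.map (λ q<b → <-trans q<b b<a) b>L) ∷ b>L ∷ dec

evalℚ-sort : ∀ L n → evalℚ (sort L) n ≡ evalℚ L n
evalℚ-sort [] n = refl
evalℚ-sort (t ∷ L) n = trans (evalℚ-insert t (sort L) n) (cong (proj₁ t * proj₂ t ^ℚ n +_) (evalℚ-sort L n))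

sort-bases : ∀ {P : ℚ → Set} {L} → Bases P L → Bases P (sort L)
sort-bases [] = []
sort-bases {L = t ∷ _} (pt ∷ ps) = insert-bases t pt (sort-bases ps)

sort-decreasing : ∀ L → Decreasing (sort L)
sort-decreasing [] = []
sort-decreasing (t ∷ L) = insert-decreasing t (sort-decreasing L)

evalℚ-dropZeros : ∀ L n → evalℚ (dropZeros L) n ≡ evalℚ L n
evalℚ-dropZeros [] n = refl
evalℚ-dropZeros ((c , a) ∷ L) n with c ≟ 0ℚ
... | yes refl = trans (evalℚ-dropZeros L n)
  (sym (trans (cong (_+ evalℚ L n) (*-zeroˡ (a ^ℚ n))) (+-identityˡ (evalℚ L n))))
... | no _ = cong (c * a ^ℚ n +_) (evalℚ-dropZeros L n)

reduce-bases : ∀ {P : ℚ → Set} {L} → Bases P L → Bases P (reduce L)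
reduce-bases = All.filter⁺ _ ∘ sort-bases

reduce-decreasing : ∀ L → Decreasing (reduce L)
reduce-decreasing L = AllPairs.filter⁺ _ (sort-decreasing L)

decreasing⇒unique : ∀ {L} → Decreasing L → Unique (map proj₂ L)
decreasing⇒unique = AllPairs.map⁺ ∘ AllPairs.map (λ t<s s≡t → <⇒≢ t<s (sym s≡t))

reduce-reducedRep : ∀ {α} L → Bases (0ℚ <_) L → (∀ n → α n ≡ evalℚ L n) → ReducedRep α (reduce L)
reduce-reducedRep L 0<L α≡L = All.all-filter _ (sort L) , reduce-bases 0<L ,
  decreasing⇒unique (reduce-decreasing L) ,
  λ n → trans (α≡L n) (sym (trans (evalℚ-dropZeros (sort L) n) (evalℚ-sort L n)))

record DominantTerm (β : ℕ → ℚ) : Set where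
  field
    coeff base : ℚ
    rest : Rep
    coeff≢0 : coeff ≢ 0ℚ
    0<base : 0ℚ < base
    0<rest : Bases (0ℚ <_) rest
    rest<base : Bases (_< base) rest
    expansion : ∀ n → β n ≡ coeff * base ^ℚ n + evalℚ rest n

dominantTerm : ∀ {β} L → Bases (0ℚ <_) L → (∀ n → β n ≡ evalℚ L n) → Nonzero β → DominantTerm β
dominantTerm L 0<L β≡L β≢0
  with reduce L | reduce-reducedRep L 0<L β≡L | reduce-decreasing L
... | [] | _ , _ , _ , β≡0 | _ = ⊥-elim (β≢0 β≡0)
... | (b , B) ∷ R | b≢0 ∷ _ , 0<B ∷ 0<R , _ , β≡ | R<B ∷ _ =
  record { coeff≢0 = b≢0 ; 0<base = 0<B ; 0<rest = 0<R ; rest<base = R<B ; expansion = β≡ }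

-- Division by a function with a dominant term

-- β = v + y with u v = 1 and δ = −u y, so α − α u (1 + ⋯ + δ^(k−1)) β = α δ^k; the
-- identity is stated with u = c e and δ unfolded to match evalℚ-scale.
geometric-cancellation : ∀ a c e v y s δ k → c * e * v ≡ 1ℚ → δ ≡ - c * e * y →
  s * (1ℚ - δ) + k ≡ 1ℚ → a - a * (c * e * s) * (v + y) ≡ a * k
geometric-cancellation a c e v y s δ k uv≡1 δ≡ geometric≡1 = begin
  a - a * (c * e * s) * (v + y)
    ≡⟨ solve 7 (λ a c e v y s k → a :- a :* (c :* e :* s) :* (v :+ y)
         := a :* k :- a :* (s :* (con 1ℚ :- (:- c) :* e :* y) :+ k :- con 1ℚ)
                   :- a :* s :* (c :* e :* v :- con 1ℚ)) refl a c e v y s k ⟩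
  a * k - a * (s * (1ℚ - - c * e * y) + k - 1ℚ) - a * s * (c * e * v - 1ℚ)
    ≡⟨ cong₂ (λ g w → a * k - a * (g - 1ℚ) - a * s * (w - 1ℚ))
         (trans (cong (λ x → s * (1ℚ - x) + k) (sym δ≡)) geometric≡1) uv≡1 ⟩
  a * k - a * (1ℚ - 1ℚ) - a * s * (1ℚ - 1ℚ)
    ≡⟨ solve 3 (λ a s k → a :* k :- a :* (con 1ℚ :- con 1ℚ) :- a :* s :* (con 1ℚ :- con 1ℚ)
         := a :* k) refl a s k ⟩
  a * k ∎
  where open ≡-Reasoning

module Division {β : ℕ → ℚ} (dom : DominantTerm β) where

  open DominantTerm dom

  instance
    coeff-nonZero : NonZero coeff
    coeff-nonZero = ≢-nonZero coeff≢0
    base-positive : Positive base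
    base-positive = positive 0<base
    base-nonZero : NonZero base
    base-nonZero = pos⇒nonZero base

  0<1/base : 0ℚ < 1/ base
  0<1/base = positive⁻¹ (1/ base) {{1/pos⇒pos base}}

  δ : Rep
  δ = scale (- 1/ coeff , 1/ base) rest

  δ-bases : Bases (λ a → 0ℚ < a × a < 1ℚ) δ
  δ-bases = scale-bases (- 1/ coeff , 1/ base) (λ (0<a , a<B) → *-positive 0<1/base 0<a ,
      subst (1/ base * _ <_) (*-inverseˡ base) (*-monoʳ-<-pos (1/ base) {{1/pos⇒pos base}} a<B))
    (All.zip (0<rest , rest<base))

  ratio : ℚ
  ratio = maxBase δ

  ratio<1 : ratio < 1ℚ
  ratio<1 = maxBase-< δ (positive⁻¹ 1ℚ) (All.map proj₂ δ-bases)

  quotient : Rep → ℕ → Rep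
  quotient L k = L ⊗ scale (1/ coeff , 1/ base) (geometric δ k)

  remainder : Rep → ℕ → Rep
  remainder L k = L ⊗ δ ^ᴿ k

  quotient-bases : ∀ {L} k → Bases (0ℚ <_) L → Bases (0ℚ <_) (quotient L k)
  quotient-bases k 0<L = ⊗-bases *-positive 0<L
    (scale-bases (1/ coeff , 1/ base) (*-positive 0<1/base)
      (geometric-bases k (positive⁻¹ 1ℚ) *-positive (All.map proj₁ δ-bases)))

  remainder-bases : ∀ {a L} k → Bases (PositiveUpTo a) L →
    Bases (PositiveUpTo (a * ratio ^ℚ k)) (remainder L k)
  remainder-bases k L≤a = ⊗-bases *-positiveUpTo L≤a
    (^ᴿ-positiveUpTo k (All.zip (All.map proj₁ δ-bases , maxBase-upper δ)))

  leading-inverse : ∀ n → 1/ coeff * (1/ base) ^ℚ n * (coeff * base ^ℚ n) ≡ 1ℚ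
  leading-inverse n = begin
    1/ coeff * (1/ base) ^ℚ n * (coeff * base ^ℚ n)
      ≡⟨ solve 4 (λ p q x y → p :* q :* (x :* y) := (p :* x) :* (q :* y))
           refl (1/ coeff) ((1/ base) ^ℚ n) coeff (base ^ℚ n) ⟩
    1/ coeff * coeff * ((1/ base) ^ℚ n * base ^ℚ n)
      ≡⟨ cong₂ _*_ (*-inverseˡ coeff) (sym (^ℚ-distribʳ-* (1/ base) base n)) ⟩
    1ℚ * (1/ base * base) ^ℚ n
      ≡⟨ cong (λ x → 1ℚ * x ^ℚ n) (*-inverseˡ base) ⟩
    1ℚ * 1ℚ ^ℚ n
      ≡⟨ trans (*-identityˡ _) (1^ℚn≡1 n) ⟩
    1ℚ ∎
    where open ≡-Reasoning

  remainder-identity : ∀ L k n →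
    evalℚ L n - evalℚ (quotient L k) n * β n ≡ evalℚ (remainder L k) n
  remainder-identity L k n = begin
    a - evalℚ (quotient L k) n * β n
      ≡⟨ cong₂ (λ q y → a - q * y) evalℚ-quotient (expansion n) ⟩
    a - a * (1/ coeff * (1/ base) ^ℚ n * s) * (coeff * base ^ℚ n + evalℚ rest n)
      ≡⟨ geometric-cancellation a (1/ coeff) ((1/ base) ^ℚ n) _ _ s _ _ (leading-inverse n)
           (evalℚ-scale (- 1/ coeff) (1/ base) rest n) (evalℚ-geometric δ k n) ⟩
    a * evalℚ δ n ^ℚ k
      ≡⟨ sym (trans (evalℚ-⊗ L (δ ^ᴿ k) n) (cong (a *_) (evalℚ-^ᴿ δ k n))) ⟩
    evalℚ (remainder L k) n ∎
    where
    open ≡-Reasoning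
    a = evalℚ L n
    s = evalℚ (geometric δ k) n
    evalℚ-quotient : evalℚ (quotient L k) n ≡ a * (1/ coeff * (1/ base) ^ℚ n * s)
    evalℚ-quotient = trans (evalℚ-⊗ L _ n)
      (cong (a *_) (evalℚ-scale (1/ coeff) (1/ base) (geometric δ k) n))

rationalBases : List (ℚ × ℕ) → Rep
rationalBases = map (λ t → (proj₁ t , ℕ→ℚ (proj₂ t)))

evalℕ≡evalℚ : ∀ L n → evalℕ L n ≡ evalℚ (rationalBases L) n
evalℕ≡evalℚ [] n = refl
evalℕ≡evalℚ ((c , a) ∷ L) n = cong (c * ℕ→ℚ a ^ℚ n +_) (evalℕ≡evalℚ L n)

rationalBases-positive : ∀ {L} → All (λ t → 0 ℕ.< proj₂ t) L → Bases (0ℚ <_) (rationalBases L)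
rationalBases-positive [] = []
rationalBases-positive {(_ , suc a) ∷ _} (_ ∷ ps) =
  positive⁻¹ _ {{normalize-pos (suc a) 1}} ∷ rationalBases-positive ps

lemma1 : (α β : ℕ → ℚ) → InE α → InE β → Nonzero α → Nonzero β →
    (t : ℚ) → 0ℚ < t →
    Σ (ℕ → ℚ) λ η → InEQ η ×
    Σ ℚ λ m → IsEll (λ n → α n - η n * β n) m × m < t
lemma1 α β (Lα , 0<Lα , α≡Lα) (Lβ , 0<Lβ , β≡Lβ) _ β≢0 t 0<t =
  η , (quotient A k , quotient-bases k 0<A , λ _ → refl) ,
  maxBase ρ , (ρ , reduce-reducedRep (remainder A k) (All.map proj₁ ρ-bounds) α-ηβ≡ , refl) ,
  ≤-<-trans ρ≤Arᵏ (proj₂ decay)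
  where
  A = rationalBases Lα
  0<A = rationalBases-positive 0<Lα
  open Division (dominantTerm (rationalBases Lβ) (rationalBases-positive 0<Lβ)
                  (λ n → trans (β≡Lβ n) (evalℕ≡evalℚ Lβ n)) β≢0)
  decay = geometric-decay (maxBase-nonNegative A) (maxBase-nonNegative δ) ratio<1 0<t
  k = proj₁ decay
  η = λ n → evalℚ (quotient A k) n
  ρ = reduce (remainder A k)
  ρ-bounds = remainder-bases k (All.zip (0<A , maxBase-upper A))
  α-ηβ≡ : ∀ n → α n - η n * β n ≡ evalℚ (remainder A k) n
  α-ηβ≡ n = trans (cong (_- η n * β n) (trans (α≡Lα n) (evalℕ≡evalℚ Lα n)))
    (remainder-identity A k n)
  ρ≤Arᵏ : maxBase ρ ≤ maxBase A * ratio ^ℚ k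
  ρ≤Arᵏ = maxBase-least ρ
    (*-nonNegative (maxBase-nonNegative A) (^ℚ-nonNegative k (maxBase-nonNegative δ)))
    (All.map proj₂ (reduce-bases ρ-bounds))
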